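{- If $f:A\to B$ and $g:C\to D$ are morphisms of $\mathbf{HRAMnet}$ (with disjoint port names), then $[\![f\otimes g]\!]=[\![f]\!]\otimes[\![g]\!]$.
   Context: Port names and interfaces. Fix disjoint countably infinite sets $\mathbb A$ (port names) and $\mathbb P$ (pointer names). Polarities $L=\{O,P\}$, $O^*=P$, $P^*=O$. A port is $(l,a)\in L\times\mathbb A$. An interface is a finite set $A$ of ports with no repeated port name; $\mathrm{sup}(A)$ its port names; $A^{(O)}$, $A^{(P)}$ its $O$-/$P$-labelled ports. For disjoint supports $A\otimes B=A\cup B$; $A^*=\{(l^*,a)\mid(l,a)\in A\}$; $A\Rightarrow B=A^*\otimes B$. Machines and nets. Data $\mathcal D=\{\emptyset\}\cup\mathbb P\cup\mathbb Z$; fixed $r_m\le r$. Engines $E=(A,P)$: interface $A$ plus a map $P$ from $\mathrm{sup}(A^{(O)})$ to code fragments over instructions $\mathtt{new},\mathtt{get},\mathtt{update},\mathtt{free},\mathtt{flip},\mathtt{set}$ (manipulating $r$ thread registers and a shared heap $\mathbb P\rightharpoonup\mathbb P\times\mathcal D$), with control $\mathtt{ifzero}$, $\mathtt{end}$, and $\mathtt{spark}\ a$ (only for $(P,a)\in A$). Engines run multiple threads; on input message $(a,\vec d)\in\mathbb A\times\mathcal D^{r_m}$ at $(O,a)\in A$ a thread running $P(a)$ with registers $\vec d$ (padded with $\emptyset$) starts; $\mathtt{spark}\ a$ jumps to $P(\chi(a))$ (passing the first $r_m$ registers) if $\chi(a)$ is an input port of the same engine, and otherwise terminates the thread and emits $(\chi(a),(d_0,\dots,d_{r_m-1}))$.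 An HRAM net $S=(\vec E,\chi,A)$ consists of engines with pairwise disjoint interface supports, external interface $A$, and a bijection $\chi:\mathrm{sup}(A^{(O)}\otimes A_{\vec E}^{(P)})\to\mathrm{sup}(A^{(P)}\otimes A_{\vec E}^{(O)})$ ($A_{\vec E}$ the tensor of the engine interfaces). Emitted messages go into a pool from which engines receive; pending messages at $(P,a)\in A$ may be observably output with label $(P,(a,\vec d))$; an observable input $(O,(a,\vec d))$ at $(O,a)\in A$ adds $(\chi(a),\vec d)$ to the pool. A trace over $A$ is a finite sequence of polarised messages with port names in $\mathrm{sup}(A)$; $[\![S]\!]$ is the set of traces of observable labels performed from the initial configuration (no threads, empty heaps, empty pool) with silent steps interspersed. Morphisms $f:A\to B$ of $\mathbf{HRAMnet}$ are nets with external interface $A\Rightarrow B$. For $f=(\vec E_f,\chi_f,A\Rightarrow B)$ and $g=(\vec E_g,\chi_g,C\Rightarrow D)$, $f\otimes g=(\vec E_f\cup\vec E_g,\chi_f\cup\chi_g,A\otimes C\Rightarrow B\otimes D)$. Trace operations: for a trace $s$ and interface $X$, $s-X$ deletes all messages whose port name is in $\mathrm{sup}(X)$. For $S_1$ a set of traces over $X$ and $S_2$ a set of traces over $Y$ (disjoint supports), the interleaving is $S_1\otimes S_2=\{s \text{ trace over } X\otimes Y\mid s-Y\in S_1,\ s-X\in S_2\}$. -}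

module Defs where

open import Data.Nat as ℕ using (ℕ; _≤_; _<?_)
open import Data.Integer using (ℤ; +_)
open import Data.Fin using (Fin; toℕ; fromℕ<; inject≤)
open import Data.Vec as Vec using (Vec; tabulate; _[_]≔_)
open import Data.List using (List; []; _∷_; _++_; map; concatMap; filter; length; lookup)
open import Data.List.Membership.Propositional using (_∈_)
open import Data.List.Relation.Unary.All using (All)
open import Data.List.Relation.Unary.Any using (any?)
open import Data.List.Relation.Unary.Unique.Propositional using (Unique)
open import Data.List.Relation.Binary.Permutation.Propositional using (_↭_)
open import Data.Product using (_×_; _,_; proj₁; proj₂)
open import Data.Maybe using (Maybe; just; nothing)
open import Data.Bool using (Bool; true; false; if_then_else_)
open import Data.Unit using (⊤)
open import Relation.Nullary using (¬_; does)
open import Relation.Nullary.Decidable using (¬?)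
open import Relation.Binary.PropositionalEquality using (_≡_)

-- Port names and pointer names (countably infinite; kept apart by the
-- constructors of 𝒟 and by never mixing them).

𝔸 : Set
𝔸 = ℕ

ℙ : Set
ℙ = ℕ

data Pol : Set where
  O P : Pol

_* : Pol → Pol
O * = P
P * = O

samePol : Pol → Pol → Bool
samePol O O = true
samePol P P = true
samePol O P = false
samePol P O = false

Port : Set
Port = Pol × 𝔸

-- An interface: finite set of ports (as a list); "no repeated port name"
-- is imposed by the well-formedness condition of nets below.
Interface : Set
Interface = List Port

sup : Interface → List 𝔸
sup = map proj₂

namesOf : Pol → Interface → List 𝔸
namesOf l [] = []
namesOf l ((l' , a) ∷ A) = if samePol l l' then a ∷ namesOf l A else namesOf l A

_⊗ᵢ_ : Interface → Interface → Interface
A ⊗ᵢ B = A ++ B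

dual : Interface → Interface
dual = map (λ p → (proj₁ p *) , proj₂ p)

_⇒_ : Interface → Interface → Interface
A ⇒ B = dual A ⊗ᵢ B

data 𝒟 : Set where
  ∅   : 𝒟
  ptr : ℙ → 𝒟
  int : ℤ → 𝒟

module HRAM (r rm : ℕ) (rm≤r : rm ≤ r) where

  Reg : Set
  Reg = Fin r

  data Instr : Set where
    new    : Reg → Reg → Reg → Instr
    get    : Reg → Reg → Reg → Instr
    update : Reg → Reg → Instr
    free   : Reg → Instr
    flip   : Reg → Reg → Instr
    set    : Reg → 𝒟 → Instr

  data Code : Set where
    end    : Code
    spark  : 𝔸 → Code
    ifzero : Reg → Code → Code → Code
    _▹_    : Instr → Code → Code

  Regs : Set
  Regs = Vec 𝒟 r

  Payload : Set
  Payload = Vec 𝒟 rm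

  Heap : Set
  Heap = ℙ → Maybe (ℙ × 𝒟)

  emptyHeap : Heap
  emptyHeap _ = nothing

  _[_↦_] : Heap → ℙ → Maybe (ℙ × 𝒟) → Heap
  (h [ p ↦ v ]) q = if does (q ℕ.≟ p) then v else h q

  pad : Payload → Regs
  pad d = tabulate λ i → padAt (toℕ i <? rm)
    where
    padAt : ∀ {n} → Relation.Nullary.Dec (n ℕ.< rm) → 𝒟
    padAt (Relation.Nullary.yes p) = Vec.lookup d (fromℕ< p)
    padAt (Relation.Nullary.no _)  = ∅

  firstRegs : Regs → Payload
  firstRegs ρ = tabulate λ i → Vec.lookup ρ (inject≤ i rm≤r)

  data Exec : Instr → Regs → Heap → Regs → Heap → Set where
    e-new    : ∀ {i j k ρ h p q} → Vec.lookup ρ j ≡ ptr q → h p ≡ nothing →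
               Exec (new i j k) ρ h (ρ [ i ]≔ ptr p) (h [ p ↦ just (q , Vec.lookup ρ k) ])
    e-get    : ∀ {i j k ρ h p q d} → Vec.lookup ρ k ≡ ptr p → h p ≡ just (q , d) →
               Exec (get i j k) ρ h ((ρ [ i ]≔ ptr q) [ j ]≔ d) h
    e-update : ∀ {i j ρ h p q d} → Vec.lookup ρ i ≡ ptr p → h p ≡ just (q , d) →
               Exec (update i j) ρ h ρ (h [ p ↦ just (q , Vec.lookup ρ j) ])
    e-free   : ∀ {i ρ h p v} → Vec.lookup ρ i ≡ ptr p → h p ≡ just v →
               Exec (free i) ρ h ρ (h [ p ↦ nothing ])
    e-flip   : ∀ {i j ρ h} →
               Exec (flip i j) ρ h ((ρ [ i ]≔ Vec.lookup ρ j) [ j ]≔ Vec.lookup ρ i) h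
    e-set    : ∀ {i d ρ h} → Exec (set i d) ρ h (ρ [ i ]≔ d) h

  -- Engines E = (A , P); P is only consulted at names a with (O , a) ∈ A.
  record Engine : Set where
    constructor engine
    field
      iface : Interface
      prog  : 𝔸 → Code
  open Engine public

  SparksOK : Interface → Code → Set
  SparksOK A end            = ⊤
  SparksOK A (spark a)      = (P , a) ∈ A
  SparksOK A (ifzero i c d) = SparksOK A c × SparksOK A d
  SparksOK A (ι ▹ c)        = SparksOK A c

  -- raw nets (engines, χ given by its graph, external interface)
  record Net : Set where
    constructor net
    field
      engines : List Engine
      chi     : List (𝔸 × 𝔸)
      ext     : Interface
  open Net public

  portNames : Net → List 𝔸
  portNames S = sup (ext S) ++ concatMap (λ E → sup (iface E)) (engines S)

  -- HRAM-net conditions: interfaces without repeated names, engine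
  -- interfaces pairwise disjoint (and disjoint from the external one),
  -- χ a bijection sup(A^(O) ⊗ A_E^(P)) → sup(A^(P) ⊗ A_E^(O)),
  -- sparks only on P-ports of the engine.
  record IsNet (S : Net) : Set where
    field
      names-unique : Unique (portNames S)
      chi-dom      : map proj₁ (chi S) ↭
                     (namesOf O (ext S) ++ concatMap (λ E → namesOf P (iface E)) (engines S))
      chi-cod      : map proj₂ (chi S) ↭
                     (namesOf P (ext S) ++ concatMap (λ E → namesOf O (iface E)) (engines S))
      sparks-ok    : All (λ E → ∀ a → (O , a) ∈ iface E → SparksOK (iface E) (prog E a))
                         (engines S)

  record Hom (A B : Interface) : Set where
    field
      homEngines : List Engine
      homChi     : List (𝔸 × 𝔸)
      homIsNet   : IsNet (net homEngines homChi (A ⇒ B))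
  open Hom public

  toNet : ∀ {A B} → Hom A B → Net
  toNet {A} {B} f = net (homEngines f) (homChi f) (A ⇒ B)

  _⊗ₕ_ : ∀ {A B C D} → Hom A B → Hom C D → Net
  _⊗ₕ_ {A} {B} {C} {D} f g =
    net (homEngines f ++ homEngines g) (homChi f ++ homChi g) ((A ⊗ᵢ C) ⇒ (B ⊗ᵢ D))

  Msg : Set
  Msg = 𝔸 × Payload

  Label : Set
  Label = Pol × Msg

  name : Label → 𝔸
  name ℓ = proj₁ (proj₂ ℓ)

  module Run (S : Net) where

    n : ℕ
    n = length (engines S)

    eng : Fin n → Engine
    eng = lookup (engines S)

    Thread : Set
    Thread = Fin n × Code × Regs

    record Config : Set where
      constructor cfg
      field
        threads : List Thread   -- multiset of threads
        heaps   : Fin n → Heap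
        pool    : List Msg      -- multiset of pending messages

    _[_≔ₕ_] : (Fin n → Heap) → Fin n → Heap → (Fin n → Heap)
    (H [ e ≔ₕ h ]) e' = if does (e' Data.Fin.≟ e) then h else H e'

    initial : Config
    initial = cfg [] (λ _ → emptyHeap) []

    -- nothing = silent step, just ℓ = observable step with label ℓ
    data Step : Config → Maybe Label → Config → Set where
      receive : ∀ {ts H p₁ p₂ a d} (e : Fin n) → (O , a) ∈ iface (eng e) →
        Step (cfg ts H (p₁ ++ (a , d) ∷ p₂)) nothing
             (cfg ((e , prog (eng e) a , pad d) ∷ ts) H (p₁ ++ p₂))
      instr : ∀ {ts₁ ts₂ H pl e ι c ρ ρ' h'} → Exec ι ρ (H e) ρ' h' →
        Step (cfg (ts₁ ++ (e , ι ▹ c , ρ) ∷ ts₂) H pl) nothing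
             (cfg (ts₁ ++ (e , c , ρ') ∷ ts₂) (H [ e ≔ₕ h' ]) pl)
      ifzero-yes : ∀ {ts₁ ts₂ H pl e i c₁ c₂ ρ} → Vec.lookup ρ i ≡ int (+ 0) →
        Step (cfg (ts₁ ++ (e , ifzero i c₁ c₂ , ρ) ∷ ts₂) H pl) nothing
             (cfg (ts₁ ++ (e , c₁ , ρ) ∷ ts₂) H pl)
      ifzero-no : ∀ {ts₁ ts₂ H pl e i c₁ c₂ ρ} → ¬ (Vec.lookup ρ i ≡ int (+ 0)) →
        Step (cfg (ts₁ ++ (e , ifzero i c₁ c₂ , ρ) ∷ ts₂) H pl) nothing
             (cfg (ts₁ ++ (e , c₂ , ρ) ∷ ts₂) H pl)
      stop : ∀ {ts₁ ts₂ H pl e ρ} →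
        Step (cfg (ts₁ ++ (e , end , ρ) ∷ ts₂) H pl) nothing
             (cfg (ts₁ ++ ts₂) H pl)
      spark-local : ∀ {ts₁ ts₂ H pl e a b ρ} → (a , b) ∈ chi S → (O , b) ∈ iface (eng e) →
        Step (cfg (ts₁ ++ (e , spark a , ρ) ∷ ts₂) H pl) nothing
             (cfg (ts₁ ++ (e , prog (eng e) b , pad (firstRegs ρ)) ∷ ts₂) H pl)
      spark-emit : ∀ {ts₁ ts₂ H pl e a b ρ} → (a , b) ∈ chi S → ¬ ((O , b) ∈ iface (eng e)) →
        Step (cfg (ts₁ ++ (e , spark a , ρ) ∷ ts₂) H pl) nothing
             (cfg (ts₁ ++ ts₂) H ((b , firstRegs ρ) ∷ pl))
      output : ∀ {ts H p₁ p₂ a d} → (P , a) ∈ ext S →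
        Step (cfg ts H (p₁ ++ (a , d) ∷ p₂)) (just (P , (a , d)))
             (cfg ts H (p₁ ++ p₂))
      input : ∀ {ts H pl a b d} → (O , a) ∈ ext S → (a , b) ∈ chi S →
        Step (cfg ts H pl) (just (O , (a , d)))
             (cfg ts H ((b , d) ∷ pl))

    data Runs (c : Config) : List Label → Set where
      done   : Runs c []
      silent : ∀ {c' s} → Step c nothing c' → Runs c' s → Runs c s
      visible : ∀ {c' ℓ s} → Step c (just ℓ) c' → Runs c' s → Runs c (ℓ ∷ s)

  TraceSet : Set₁
  TraceSet = List Label → Set

  ⟦_⟧ : Net → TraceSet
  ⟦ S ⟧ s = Run.Runs S (Run.initial S) s

  _−_ : List Label → Interface → List Label
  s − X = filter (λ ℓ → ¬? (any? (λ b → name ℓ ℕ.≟ b) (sup X))) s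

  TraceOver : Interface → List Label → Set
  TraceOver X s = All (λ ℓ → name ℓ ∈ sup X) s

  interleave : Interface → Interface → TraceSet → TraceSet → TraceSet
  interleave X Y S₁ S₂ s = TraceOver (X ⊗ᵢ Y) s × S₁ (s − Y) × S₂ (s − X)

  _≐_ : TraceSet → TraceSet → Set
  S ≐ T = ∀ s → (S s → T s) × (T s → S s)

module Submission where

-- Run the two nets side by side. A configuration of f ⊗ g is related to a pair of component
-- configurations when its threads and pending messages are an interleaving of theirs and each
-- engine's heap is the heap of the corresponding component engine. Since f and g share no port
-- names, every step of f ⊗ g is a step of exactly one component, and every step of a component
-- is a step of f ⊗ g; a visible step carries a port name of its own component, so it survives
-- deleting the other component's names. Hence traces of f ⊗ g are exactly the interleavings.

open import Defs
open import Level using (Level; _⊔_)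
open import Function using (_∘_)
open import Data.Nat as ℕ using (ℕ; _≤_)
open import Data.Integer using (+_)
open import Data.Fin as Fin using (Fin; zero; suc)
open import Data.Fin.Properties using (suc-injective)
open import Data.Vec as Vec using ()
open import Data.Maybe using (Maybe; just; nothing)
open import Data.Product as Product using (∃; _×_; _,_; -,_; proj₁; proj₂)
open import Data.Sum as Sum using (_⊎_; inj₁; inj₂)
open import Data.Empty using (⊥-elim)
open import Data.List using (List; []; _∷_; _++_; length; lookup; concatMap)
open import Data.List.Properties using (filter-accept; filter-reject; map-++)
open import Data.List.Membership.Propositional using (_∈_; lose)
open import Data.List.Membership.Propositional.Properties
  using (∈-++⁻; ∈-++⁺ˡ; ∈-++⁺ʳ; ∈-map⁺; ∈-lookup; ∈-concatMap⁺; ∈-concatMap⁻)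
open import Data.List.Relation.Unary.All as All using ([]; _∷_)
open import Data.List.Relation.Unary.Any as Any using (any?)
open import Data.List.Relation.Binary.Disjoint.Propositional using (Disjoint)
open import Data.List.Relation.Binary.Permutation.Propositional.Properties using (∈-resp-↭)
open import Data.List.Relation.Ternary.Interleaving as Interleaving
  using (Interleaving; _∷ˡ_; _∷ʳ_; swap)
open import Relation.Nullary using (¬_; yes; no)
open import Relation.Nullary.Decidable using (¬?)
open import Relation.Binary.Core using (REL)
open import Relation.Binary.PropositionalEquality using (_≡_; _≢_; refl; sym; cong; subst)

module _ {a} {X : Set a} where

  inject++ˡ : (xs ys : List X) → Fin (length xs) → Fin (length (xs ++ ys))
  inject++ˡ (x ∷ xs) ys zero    = zero
  inject++ˡ (x ∷ xs) ys (suc i) = suc (inject++ˡ xs ys i)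

  inject++ʳ : (xs ys : List X) → Fin (length ys) → Fin (length (xs ++ ys))
  inject++ʳ []       ys j = j
  inject++ʳ (x ∷ xs) ys j = suc (inject++ʳ xs ys j)

  lookup-inject++ˡ : ∀ xs ys i → lookup (xs ++ ys) (inject++ˡ xs ys i) ≡ lookup xs i
  lookup-inject++ˡ (x ∷ xs) ys zero    = refl
  lookup-inject++ˡ (x ∷ xs) ys (suc i) = lookup-inject++ˡ xs ys i

  lookup-inject++ʳ : ∀ xs ys j → lookup (xs ++ ys) (inject++ʳ xs ys j) ≡ lookup ys j
  lookup-inject++ʳ []       ys j = refl
  lookup-inject++ʳ (x ∷ xs) ys j = lookup-inject++ʳ xs ys j

  inject++ˡ-injective : ∀ xs ys {i j} → inject++ˡ xs ys i ≡ inject++ˡ xs ys j → i ≡ j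
  inject++ˡ-injective (x ∷ xs) ys {zero}  {zero}  eq = refl
  inject++ˡ-injective (x ∷ xs) ys {suc i} {suc j} eq =
    cong suc (inject++ˡ-injective xs ys (suc-injective eq))

  inject++ʳ-injective : ∀ xs ys {i j} → inject++ʳ xs ys i ≡ inject++ʳ xs ys j → i ≡ j
  inject++ʳ-injective []       ys eq = eq
  inject++ʳ-injective (x ∷ xs) ys eq = inject++ʳ-injective xs ys (suc-injective eq)

  inject++ˡ≢inject++ʳ : ∀ xs ys i j → inject++ˡ xs ys i ≢ inject++ʳ xs ys j
  inject++ˡ≢inject++ʳ (x ∷ xs) ys zero    j ()
  inject++ˡ≢inject++ʳ (x ∷ xs) ys (suc i) j eq =
    inject++ˡ≢inject++ʳ xs ys i j (suc-injective eq)

  inject++-cover : ∀ xs ys k →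
                   (∃ λ i → inject++ˡ xs ys i ≡ k) ⊎ (∃ λ j → inject++ʳ xs ys j ≡ k)
  inject++-cover []       ys k       = inj₂ (k , refl)
  inject++-cover (x ∷ xs) ys zero    = inj₁ (zero , refl)
  inject++-cover (x ∷ xs) ys (suc k) with inject++-cover xs ys k
  ... | inj₁ (i , refl) = inj₁ (suc i , refl)
  ... | inj₂ (j , refl) = inj₂ (j , refl)

module _ {a ℓ : Level} where

  record Aligned {A B C : Set a} (L : REL A C ℓ) (R : REL B C ℓ)
                 (l₁ : List A) (y : A) (l₂ : List A) (rs : List B)
                 (cs₁ : List C) (x : C) (cs₂ : List C) : Set (a ⊔ ℓ) where
    constructor aligned
    field
      related : L y x
      replace : ∀ {y′ x′} → L y′ x′ → Interleaving L R (l₁ ++ y′ ∷ l₂) rs (cs₁ ++ x′ ∷ cs₂)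
      remove  : Interleaving L R (l₁ ++ l₂) rs (cs₁ ++ cs₂)

  data Origin {A B C : Set a} (L : REL A C ℓ) (R : REL B C ℓ) (ls : List A) (rs : List B)
              (cs₁ : List C) (x : C) (cs₂ : List C) : Set (a ⊔ ℓ) where
    fromˡ : ∀ {l₁ y l₂} → ls ≡ l₁ ++ y ∷ l₂ → Aligned L R l₁ y l₂ rs cs₁ x cs₂ →
            Origin L R ls rs cs₁ x cs₂
    fromʳ : ∀ {r₁ y r₂} → rs ≡ r₁ ++ y ∷ r₂ → Aligned R L r₁ y r₂ ls cs₁ x cs₂ →
            Origin L R ls rs cs₁ x cs₂

  record Located {A B C : Set a} (L : REL A C ℓ) (R : REL B C ℓ)
                 (l₁ : List A) (y : A) (l₂ : List A) (rs : List B) (cs : List C) : Set (a ⊔ ℓ) where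
    constructor located
    field
      {cs₁ cs₂} : List C
      {x}       : C
      cs≡       : cs ≡ cs₁ ++ x ∷ cs₂
      alignment : Aligned L R l₁ y l₂ rs cs₁ x cs₂

  module _ {A B C : Set a} {L : REL A C ℓ} {R : REL B C ℓ} where

    Aligned-∷ˡ : ∀ {a c l₁ y l₂ rs cs₁ x cs₂} → L a c → Aligned L R l₁ y l₂ rs cs₁ x cs₂ →
                 Aligned L R (a ∷ l₁) y l₂ rs (c ∷ cs₁) x cs₂
    Aligned-∷ˡ p (aligned rel rep rem) = aligned rel (λ q → p ∷ˡ rep q) (p ∷ˡ rem)

    Aligned-∷ʳ : ∀ {b c l₁ y l₂ rs cs₁ x cs₂} → R b c → Aligned L R l₁ y l₂ rs cs₁ x cs₂ →
                 Aligned L R l₁ y l₂ (b ∷ rs) (c ∷ cs₁) x cs₂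
    Aligned-∷ʳ p (aligned rel rep rem) = aligned rel (λ q → p ∷ʳ rep q) (p ∷ʳ rem)

  module _ {A B C : Set a} {L : REL A C ℓ} {R : REL B C ℓ} where

    origin : ∀ cs₁ {x cs₂ ls rs} → Interleaving L R ls rs (cs₁ ++ x ∷ cs₂) →
             Origin L R ls rs cs₁ x cs₂
    origin []        (p ∷ˡ sp) = fromˡ {l₁ = []} refl (aligned p (_∷ˡ sp) sp)
    origin []        (p ∷ʳ sp) = fromʳ {r₁ = []} refl (aligned p (_∷ˡ swap sp) (swap sp))
    origin (c ∷ cs₁) (p ∷ˡ sp) with origin cs₁ sp
    ... | fromˡ refl al = fromˡ refl (Aligned-∷ˡ p al)
    ... | fromʳ refl al = fromʳ refl (Aligned-∷ʳ p al)
    origin (c ∷ cs₁) (p ∷ʳ sp) with origin cs₁ sp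
    ... | fromˡ refl al = fromˡ refl (Aligned-∷ʳ p al)
    ... | fromʳ refl al = fromʳ refl (Aligned-∷ˡ p al)

    locate : ∀ l₁ {y l₂ rs cs} → Interleaving L R (l₁ ++ y ∷ l₂) rs cs →
             Located L R l₁ y l₂ rs cs
    locate []       (p ∷ˡ sp) = located {cs₁ = []} refl (aligned p (_∷ˡ sp) sp)
    locate (a ∷ l₁) (p ∷ˡ sp) with locate l₁ sp
    ... | located refl al = located refl (Aligned-∷ˡ p al)
    locate l₁       (p ∷ʳ sp) with locate l₁ sp
    ... | located refl al = located refl (Aligned-∷ʳ p al)

module _ {A B C D : Interface} where

  ⇒-⊗⁺ˡ : ∀ {p} → p ∈ A ⇒ B → p ∈ (A ⊗ᵢ C) ⇒ (B ⊗ᵢ D)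
  ⇒-⊗⁺ˡ p∈ with ∈-++⁻ (dual A) p∈
  ... | inj₁ p∈A = ∈-++⁺ˡ (subst (_ ∈_) (sym (map-++ _ A C)) (∈-++⁺ˡ p∈A))
  ... | inj₂ p∈B = ∈-++⁺ʳ (dual (A ⊗ᵢ C)) (∈-++⁺ˡ p∈B)

  ⇒-⊗⁺ʳ : ∀ {p} → p ∈ C ⇒ D → p ∈ (A ⊗ᵢ C) ⇒ (B ⊗ᵢ D)
  ⇒-⊗⁺ʳ p∈ with ∈-++⁻ (dual C) p∈
  ... | inj₁ p∈C = ∈-++⁺ˡ (subst (_ ∈_) (sym (map-++ _ A C)) (∈-++⁺ʳ (dual A) p∈C))
  ... | inj₂ p∈D = ∈-++⁺ʳ (dual (A ⊗ᵢ C)) (∈-++⁺ʳ B p∈D)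

  ⇒-⊗⁻ : ∀ {p} → p ∈ (A ⊗ᵢ C) ⇒ (B ⊗ᵢ D) → p ∈ A ⇒ B ⊎ p ∈ C ⇒ D
  ⇒-⊗⁻ p∈ with ∈-++⁻ (dual (A ⊗ᵢ C)) p∈
  ... | inj₂ p∈BD = Sum.map (∈-++⁺ʳ (dual A)) (∈-++⁺ʳ (dual C)) (∈-++⁻ B p∈BD)
  ... | inj₁ p∈AC = Sum.map ∈-++⁺ˡ ∈-++⁺ˡ (∈-++⁻ (dual A) (subst (_ ∈_) (map-++ _ A C) p∈AC))

namesOf⊆sup : ∀ l A {a} → a ∈ namesOf l A → a ∈ sup A
namesOf⊆sup l [] ()
namesOf⊆sup O ((O , _) ∷ A) (Any.here eq) = Any.here eq
namesOf⊆sup O ((O , _) ∷ A) (Any.there p) = Any.there (namesOf⊆sup O A p)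
namesOf⊆sup O ((P , _) ∷ A) p             = Any.there (namesOf⊆sup O A p)
namesOf⊆sup P ((P , _) ∷ A) (Any.here eq) = Any.here eq
namesOf⊆sup P ((P , _) ∷ A) (Any.there p) = Any.there (namesOf⊆sup P A p)
namesOf⊆sup P ((O , _) ∷ A) p             = Any.there (namesOf⊆sup P A p)

module Simulation (r rm : ℕ) (rm≤r : rm ≤ r) where

  open HRAM r rm rm≤r

  module PortNames (S : Net) where
    open Run S

    ext⊆portNames : ∀ {l a} → (l , a) ∈ ext S → a ∈ portNames S
    ext⊆portNames p = ∈-++⁺ˡ (∈-map⁺ proj₂ p)

    iface⊆portNames : ∀ e {l a} → (l , a) ∈ iface (eng e) → a ∈ portNames S
    iface⊆portNames e p = ∈-++⁺ʳ (sup (ext S))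
      (∈-concatMap⁺ (sup ∘ iface) (lose (∈-lookup {xs = engines S} e) (∈-map⁺ proj₂ p)))

    polarised⊆portNames : ∀ l l′ {a} →
      a ∈ namesOf l (ext S) ++ concatMap (λ E → namesOf l′ (iface E)) (engines S) → a ∈ portNames S
    polarised⊆portNames l l′ p with ∈-++⁻ (namesOf l (ext S)) p
    ... | inj₁ q = ∈-++⁺ˡ (namesOf⊆sup l (ext S) q)
    ... | inj₂ q = ∈-++⁺ʳ (sup (ext S)) (∈-concatMap⁺ (sup ∘ iface) {engines S}
                     (Any.map (λ {E} → namesOf⊆sup l′ (iface E))
                              (∈-concatMap⁻ (namesOf l′ ∘ iface) {engines S} q)))

    module _ (isNet : IsNet S) where
      open IsNet isNet

      chi-dom⊆portNames : ∀ {a b} → (a , b) ∈ chi S → a ∈ portNames S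
      chi-dom⊆portNames p = polarised⊆portNames O P (∈-resp-↭ chi-dom (∈-map⁺ proj₁ p))

      chi-cod⊆portNames : ∀ {a b} → (a , b) ∈ chi S → b ∈ portNames S
      chi-cod⊆portNames p = polarised⊆portNames P O (∈-resp-↭ chi-cod (∈-map⁺ proj₂ p))

      prog-sparksOK : ∀ e {a} → (O , a) ∈ iface (eng e) → SparksOK (iface (eng e)) (prog (eng e) a)
      prog-sparksOK e = All.lookup sparks-ok (∈-lookup e) _

  record Embedding (S S₁ : Net) : Set where
    field
      isNet            : IsNet S₁
      embed            : Fin (Run.n S₁) → Fin (Run.n S)
      eng-embed        : ∀ e → Run.eng S (embed e) ≡ Run.eng S₁ e
      embed-injective  : ∀ {i j} → embed i ≡ embed j → i ≡ j
      chi⁺             : ∀ {p} → p ∈ chi S₁ → p ∈ chi S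
      ext⁺             : ∀ {p} → p ∈ ext S₁ → p ∈ ext S

    -- Besides matching up, threads and messages carry the invariants (a thread only sparks its
    -- engine's own P-ports; a message is addressed inside S₁) that let each step of S be
    -- attributed to the component owning the thread or message involved.
    ThreadRel : Run.Thread S₁ → Run.Thread S → Set
    ThreadRel t k = k ≡ (embed (proj₁ t) , proj₂ t)
                  × SparksOK (iface (Run.eng S₁ (proj₁ t))) (proj₁ (proj₂ t))

    MsgRel : Msg → Msg → Set
    MsgRel m k = k ≡ m × proj₁ m ∈ portNames S₁

  record Juxtaposition (S S₁ S₂ : Net) : Set where
    field
      left      : Embedding S S₁
      right     : Embedding S S₂
      disjoint  : Disjoint (portNames S₁) (portNames S₂)
      embed≢    : ∀ i j → Embedding.embed left i ≢ Embedding.embed right j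
      embed⁻    : ∀ k → (∃ λ i → Embedding.embed left i ≡ k) ⊎ (∃ λ j → Embedding.embed right j ≡ k)
      chi⁻      : ∀ {p} → p ∈ chi S → p ∈ chi S₁ ⊎ p ∈ chi S₂
      ext⁻      : ∀ {p} → p ∈ ext S → p ∈ ext S₁ ⊎ p ∈ ext S₂

  Juxtaposition-swap : ∀ {S S₁ S₂} → Juxtaposition S S₁ S₂ → Juxtaposition S S₂ S₁
  Juxtaposition-swap J = record
    { left     = right
    ; right    = left
    ; disjoint = disjoint ∘ Product.swap
    ; embed≢   = λ i j eq → embed≢ j i (sym eq)
    ; embed⁻   = Sum.swap ∘ embed⁻
    ; chi⁻     = Sum.swap ∘ chi⁻
    ; ext⁻     = Sum.swap ∘ ext⁻
    }
    where open Juxtaposition J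

  module _ {S S₁ S₂ : Net} (E₁ : Embedding S S₁) (E₂ : Embedding S S₂) where
    private
      module K  = Run S
      module C₁ = Run S₁
      module C₂ = Run S₂
      module E₁ = Embedding E₁
      module E₂ = Embedding E₂

    record Rel (c : K.Config) (c₁ : C₁.Config) (c₂ : C₂.Config) : Set where
      constructor rel
      field
        threads : Interleaving E₁.ThreadRel E₂.ThreadRel
                    (C₁.Config.threads c₁) (C₂.Config.threads c₂) (K.Config.threads c)
        heaps₁  : ∀ i → K.Config.heaps c (E₁.embed i) ≡ C₁.Config.heaps c₁ i
        heaps₂  : ∀ j → K.Config.heaps c (E₂.embed j) ≡ C₂.Config.heaps c₂ j
        pool    : Interleaving E₁.MsgRel E₂.MsgRel
                    (C₁.Config.pool c₁) (C₂.Config.pool c₂) (K.Config.pool c)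

  Rel-swap : ∀ {S S₁ S₂} {E₁ : Embedding S S₁} {E₂ : Embedding S S₂} {c c₁ c₂} →
             Rel E₁ E₂ c c₁ c₂ → Rel E₂ E₁ c c₂ c₁
  Rel-swap (rel ts h₁ h₂ pl) = rel (swap ts) h₂ h₁ (swap pl)

  module Side {S S₁ S₂ : Net} (J : Juxtaposition S S₁ S₂) where
    open Juxtaposition J
    private
      module K  = Run S
      module C₁ = Run S₁
      module C₂ = Run S₂
      module E₁ = Embedding left
      module E₂ = Embedding right
    open E₁ using (embed; eng-embed; isNet)

    Rel₁₂ : K.Config → C₁.Config → C₂.Config → Set
    Rel₁₂ = Rel left right

    embed-update : ∀ {H : Fin K.n → Heap} {H₁ : Fin C₁.n → Heap} e h →
                   (∀ i → H (embed i) ≡ H₁ i) →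
                   ∀ i → (H K.[ embed e ≔ₕ h ]) (embed i) ≡ (H₁ C₁.[ e ≔ₕ h ]) i
    embed-update e h agree i with i Fin.≟ e | embed i Fin.≟ embed e
    ... | yes _   | yes _   = refl
    ... | no  _   | no  _   = agree i
    ... | yes i≡e | no  i≢e = ⊥-elim (i≢e (cong embed i≡e))
    ... | no  i≢e | yes eq  = ⊥-elim (i≢e (E₁.embed-injective eq))

    other-update : ∀ {H : Fin K.n → Heap} {H₂ : Fin C₂.n → Heap} e h →
                   (∀ j → H (E₂.embed j) ≡ H₂ j) →
                   ∀ j → (H K.[ embed e ≔ₕ h ]) (E₂.embed j) ≡ H₂ j
    other-update e h agree j with E₂.embed j Fin.≟ embed e
    ... | yes eq = ⊥-elim (embed≢ e j (sym eq))
    ... | no  _  = agree j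

    iface-embed⁺ : ∀ e {p} → p ∈ iface (C₁.eng e) → p ∈ iface (K.eng (embed e))
    iface-embed⁺ e = subst (λ E → _ ∈ iface E) (sym (eng-embed e))

    iface-embed⁻ : ∀ e {p} → p ∈ iface (K.eng (embed e)) → p ∈ iface (C₁.eng e)
    iface-embed⁻ e = subst (λ E → _ ∈ iface E) (eng-embed e)

    started : ∀ e {a} ρ → (O , a) ∈ iface (C₁.eng e) →
              E₁.ThreadRel (e , prog (C₁.eng e) a , ρ) (embed e , prog (K.eng (embed e)) a , ρ)
    started e ρ a∈ =
      cong (λ E → embed e , prog E _ , ρ) (eng-embed e) , PortNames.prog-sparksOK S₁ isNet e a∈

    emitted : ∀ {a b} d → (a , b) ∈ chi S₁ → E₁.MsgRel (b , d) (b , d)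
    emitted d ab∈ = refl , PortNames.chi-cod⊆portNames S₁ isNet ab∈

    lift : ∀ {c c₁ c₁′ c₂ m} → Rel₁₂ c c₁ c₂ → C₁.Step c₁ m c₁′ →
           ∃ λ c′ → K.Step c m c′ × Rel₁₂ c′ c₁′ c₂
    lift (rel ts h₁ h₂ pl) (C₁.receive {p₁ = p₁} {d = d} e a∈) with locate p₁ pl
    ... | located refl (aligned (refl , _) _ remove) =
      -, K.receive (embed e) (iface-embed⁺ e a∈) , rel (started e (pad d) a∈ ∷ˡ ts) h₁ h₂ remove
    lift {K.cfg _ H _} (rel ts h₁ h₂ pl) (C₁.instr {ts₁ = l₁} {e = e} {ρ' = ρ′} {h' = h′} ex)
      with locate l₁ ts
    ... | located refl (aligned (refl , ok) replace _) =
      -, K.instr (subst (λ h → Exec _ _ h ρ′ h′) (sym (h₁ e)) ex) ,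
      rel (replace (refl , ok)) (embed-update {H} e h′ h₁) (other-update {H} e h′ h₂) pl
    lift (rel ts h₁ h₂ pl) (C₁.ifzero-yes {ts₁ = l₁} z) with locate l₁ ts
    ... | located refl (aligned (refl , ok) replace _) =
      -, K.ifzero-yes z , rel (replace (refl , proj₁ ok)) h₁ h₂ pl
    lift (rel ts h₁ h₂ pl) (C₁.ifzero-no {ts₁ = l₁} z) with locate l₁ ts
    ... | located refl (aligned (refl , ok) replace _) =
      -, K.ifzero-no z , rel (replace (refl , proj₂ ok)) h₁ h₂ pl
    lift (rel ts h₁ h₂ pl) (C₁.stop {ts₁ = l₁}) with locate l₁ ts
    ... | located refl (aligned (refl , _) _ remove) = -, K.stop , rel remove h₁ h₂ pl
    lift (rel ts h₁ h₂ pl) (C₁.spark-local {ts₁ = l₁} {e = e} {ρ = ρ} ab∈ b∈) with locate l₁ ts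
    ... | located refl (aligned (refl , _) replace _) =
      -, K.spark-local (E₁.chi⁺ ab∈) (iface-embed⁺ e b∈) ,
      rel (replace (started e (pad (firstRegs ρ)) b∈)) h₁ h₂ pl
    lift (rel ts h₁ h₂ pl) (C₁.spark-emit {ts₁ = l₁} {e = e} {ρ = ρ} ab∈ b∉) with locate l₁ ts
    ... | located refl (aligned (refl , _) _ remove) =
      -, K.spark-emit (E₁.chi⁺ ab∈) (b∉ ∘ iface-embed⁻ e) ,
      rel remove h₁ h₂ (emitted (firstRegs ρ) ab∈ ∷ˡ pl)
    lift (rel ts h₁ h₂ pl) (C₁.output {p₁ = p₁} a∈) with locate p₁ pl
    ... | located refl (aligned (refl , _) _ remove) =
      -, K.output (E₁.ext⁺ a∈) , rel ts h₁ h₂ remove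
    lift (rel ts h₁ h₂ pl) (C₁.input {d = d} a∈ ab∈) =
      -, K.input (E₁.ext⁺ a∈) (E₁.chi⁺ ab∈) , rel ts h₁ h₂ (emitted d ab∈ ∷ˡ pl)

    record LiftedTo (c : K.Config) (c₂ : C₂.Config) (ℓ : Label) (t : List Label) : Set where
      constructor lifted
      field
        {c′}    : K.Config
        {c₁′}   : C₁.Config
        related : Rel₁₂ c′ c₁′ c₂
        rest    : C₁.Runs c₁′ t
        prefix  : ∀ {u} → K.Runs c′ u → K.Runs c (ℓ ∷ u)

    lift-visible : ∀ {c c₁ c₂ ℓ t} → Rel₁₂ c c₁ c₂ → C₁.Runs c₁ (ℓ ∷ t) → LiftedTo c c₂ ℓ t
    lift-visible R (C₁.silent st r) with lift R st
    ... | _ , st′ , R′ with lift-visible R′ r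
    ...   | lifted R″ r′ prefix = lifted R″ r′ (K.silent st′ ∘ prefix)
    lift-visible R (C₁.visible st r) with lift R st
    ... | _ , st′ , R′ = lifted R′ r (K.visible st′)

    Moves : K.Config → Maybe Label → C₁.Config → C₂.Config → Set
    Moves c′ m c₁ c₂ = ∃ λ c₁′ → C₁.Step c₁ m c₁′ × Rel₁₂ c′ c₁′ c₂

    ThreadAt : List K.Thread → K.Thread → List K.Thread → List C₁.Thread → C₁.Thread →
               List C₁.Thread → C₂.Config → Set
    ThreadAt cs₁ k cs₂ l₁ t l₂ c₂ =
      Aligned E₁.ThreadRel E₂.ThreadRel l₁ t l₂ (C₂.Config.threads c₂) cs₁ k cs₂

    MsgAt : List Msg → Msg → List Msg → List Msg → Msg → List Msg → C₂.Config → Set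
    MsgAt ps₁ m ps₂ q₁ n q₂ c₂ = Aligned E₁.MsgRel E₂.MsgRel q₁ n q₂ (C₂.Config.pool c₂) ps₁ m ps₂

    own-chi : ∀ {a b} → a ∈ portNames S₁ → (a , b) ∈ chi S → (a , b) ∈ chi S₁
    own-chi a∈ ab∈ with chi⁻ ab∈
    ... | inj₁ ab∈₁ = ab∈₁
    ... | inj₂ ab∈₂ = ⊥-elim (disjoint (a∈ , PortNames.chi-dom⊆portNames S₂ E₂.isNet ab∈₂))

    own-ext : ∀ {l a} → a ∈ portNames S₁ → (l , a) ∈ ext S → (l , a) ∈ ext S₁
    own-ext a∈ la∈ with ext⁻ la∈
    ... | inj₁ la∈₁ = la∈₁
    ... | inj₂ la∈₂ = ⊥-elim (disjoint (a∈ , PortNames.ext⊆portNames S₂ la∈₂))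

    own-engine : ∀ {l a} k → a ∈ portNames S₁ → (l , a) ∈ iface (K.eng k) → ∃ λ e → embed e ≡ k
    own-engine k a∈ la∈ with embed⁻ k
    ... | inj₁ owned  = owned
    ... | inj₂ (j , refl) =
      ⊥-elim (disjoint (a∈ , PortNames.iface⊆portNames S₂ j
                               (subst (λ E → _ ∈ iface E) (E₂.eng-embed j) la∈)))

    forward-instr : ∀ {cs₁ cs₂ l₁ l₂ t H pl H₁ p₁ c₂ k ι c ρ ρ′ h′} →
      Rel₁₂ (K.cfg (cs₁ ++ (k , ι ▹ c , ρ) ∷ cs₂) H pl) (C₁.cfg (l₁ ++ t ∷ l₂) H₁ p₁) c₂ →
      ThreadAt cs₁ (k , ι ▹ c , ρ) cs₂ l₁ t l₂ c₂ → Exec ι ρ (H k) ρ′ h′ →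
      Moves (K.cfg (cs₁ ++ (k , c , ρ′) ∷ cs₂) (H K.[ k ≔ₕ h′ ]) pl) nothing
            (C₁.cfg (l₁ ++ t ∷ l₂) H₁ p₁) c₂
    forward-instr {H = H} {ρ′ = ρ′} {h′} (rel _ h₁ h₂ pl) (aligned (refl , ok) replace _) ex =
      -, C₁.instr (subst (λ h → Exec _ _ h ρ′ h′) (h₁ _) ex) ,
      rel (replace (refl , ok)) (embed-update {H} _ h′ h₁) (other-update {H} _ h′ h₂) pl

    forward-ifzero-yes : ∀ {cs₁ cs₂ l₁ l₂ t H pl H₁ p₁ c₂ k i c c′ ρ} →
      Rel₁₂ (K.cfg (cs₁ ++ (k , ifzero i c c′ , ρ) ∷ cs₂) H pl) (C₁.cfg (l₁ ++ t ∷ l₂) H₁ p₁) c₂ →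
      ThreadAt cs₁ (k , ifzero i c c′ , ρ) cs₂ l₁ t l₂ c₂ → Vec.lookup ρ i ≡ int (+ 0) →
      Moves (K.cfg (cs₁ ++ (k , c , ρ) ∷ cs₂) H pl) nothing (C₁.cfg (l₁ ++ t ∷ l₂) H₁ p₁) c₂
    forward-ifzero-yes (rel _ h₁ h₂ pl) (aligned (refl , ok) replace _) z =
      -, C₁.ifzero-yes z , rel (replace (refl , proj₁ ok)) h₁ h₂ pl

    forward-ifzero-no : ∀ {cs₁ cs₂ l₁ l₂ t H pl H₁ p₁ c₂ k i c c′ ρ} →
      Rel₁₂ (K.cfg (cs₁ ++ (k , ifzero i c c′ , ρ) ∷ cs₂) H pl) (C₁.cfg (l₁ ++ t ∷ l₂) H₁ p₁) c₂ →
      ThreadAt cs₁ (k , ifzero i c c′ , ρ) cs₂ l₁ t l₂ c₂ → ¬ Vec.lookup ρ i ≡ int (+ 0) →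
      Moves (K.cfg (cs₁ ++ (k , c′ , ρ) ∷ cs₂) H pl) nothing (C₁.cfg (l₁ ++ t ∷ l₂) H₁ p₁) c₂
    forward-ifzero-no (rel _ h₁ h₂ pl) (aligned (refl , ok) replace _) nz =
      -, C₁.ifzero-no nz , rel (replace (refl , proj₂ ok)) h₁ h₂ pl

    forward-stop : ∀ {cs₁ cs₂ l₁ l₂ t H pl H₁ p₁ c₂ k ρ} →
      Rel₁₂ (K.cfg (cs₁ ++ (k , end , ρ) ∷ cs₂) H pl) (C₁.cfg (l₁ ++ t ∷ l₂) H₁ p₁) c₂ →
      ThreadAt cs₁ (k , end , ρ) cs₂ l₁ t l₂ c₂ →
      Moves (K.cfg (cs₁ ++ cs₂) H pl) nothing (C₁.cfg (l₁ ++ t ∷ l₂) H₁ p₁) c₂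
    forward-stop (rel _ h₁ h₂ pl) (aligned (refl , _) _ remove) = -, C₁.stop , rel remove h₁ h₂ pl

    forward-spark-local : ∀ {cs₁ cs₂ l₁ l₂ t H pl H₁ p₁ c₂ k a b ρ} →
      Rel₁₂ (K.cfg (cs₁ ++ (k , spark a , ρ) ∷ cs₂) H pl) (C₁.cfg (l₁ ++ t ∷ l₂) H₁ p₁) c₂ →
      ThreadAt cs₁ (k , spark a , ρ) cs₂ l₁ t l₂ c₂ → (a , b) ∈ chi S → (O , b) ∈ iface (K.eng k) →
      Moves (K.cfg (cs₁ ++ (k , prog (K.eng k) b , pad (firstRegs ρ)) ∷ cs₂) H pl) nothing
            (C₁.cfg (l₁ ++ t ∷ l₂) H₁ p₁) c₂
    forward-spark-local {t = e , _} {ρ = ρ} (rel _ h₁ h₂ pl) (aligned (refl , a∈) replace _)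
                        ab∈ b∈ =
      -, C₁.spark-local (own-chi (iface⊆portNames e a∈) ab∈) b∈₁ ,
      rel (replace (started e (pad (firstRegs ρ)) b∈₁)) h₁ h₂ pl
      where open PortNames S₁
            b∈₁ = iface-embed⁻ e b∈

    forward-spark-emit : ∀ {cs₁ cs₂ l₁ l₂ t H pl H₁ p₁ c₂ k a b ρ} →
      Rel₁₂ (K.cfg (cs₁ ++ (k , spark a , ρ) ∷ cs₂) H pl) (C₁.cfg (l₁ ++ t ∷ l₂) H₁ p₁) c₂ →
      ThreadAt cs₁ (k , spark a , ρ) cs₂ l₁ t l₂ c₂ →
      (a , b) ∈ chi S → ¬ (O , b) ∈ iface (K.eng k) →
      Moves (K.cfg (cs₁ ++ cs₂) H ((b , firstRegs ρ) ∷ pl)) nothing (C₁.cfg (l₁ ++ t ∷ l₂) H₁ p₁) c₂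
    forward-spark-emit {t = e , _} {ρ = ρ} (rel _ h₁ h₂ pl) (aligned (refl , a∈) _ remove) ab∈ b∉ =
      -, C₁.spark-emit ab∈₁ (b∉ ∘ iface-embed⁺ e) ,
      rel remove h₁ h₂ (emitted (firstRegs ρ) ab∈₁ ∷ˡ pl)
      where ab∈₁ = own-chi (PortNames.iface⊆portNames S₁ e a∈) ab∈

    forward-receive : ∀ {ps₁ ps₂ q₁ q₂ n ts H tl H₁ c₂ k a d} →
      Rel₁₂ (K.cfg ts H (ps₁ ++ (a , d) ∷ ps₂)) (C₁.cfg tl H₁ (q₁ ++ n ∷ q₂)) c₂ →
      MsgAt ps₁ (a , d) ps₂ q₁ n q₂ c₂ → (O , a) ∈ iface (K.eng k) →
      Moves (K.cfg ((k , prog (K.eng k) a , pad d) ∷ ts) H (ps₁ ++ ps₂)) nothing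
            (C₁.cfg tl H₁ (q₁ ++ n ∷ q₂)) c₂
    forward-receive {k = k} {d = d} (rel ts h₁ h₂ _) (aligned (refl , a∈) _ remove) a∈k
      with own-engine k a∈ a∈k
    ... | e , refl = -, C₁.receive e a∈₁ , rel (started e (pad d) a∈₁ ∷ˡ ts) h₁ h₂ remove
      where a∈₁ = iface-embed⁻ e a∈k

    forward-output : ∀ {ps₁ ps₂ q₁ q₂ n ts H tl H₁ c₂ a d} →
      Rel₁₂ (K.cfg ts H (ps₁ ++ (a , d) ∷ ps₂)) (C₁.cfg tl H₁ (q₁ ++ n ∷ q₂)) c₂ →
      MsgAt ps₁ (a , d) ps₂ q₁ n q₂ c₂ → (P , a) ∈ ext S →
      Moves (K.cfg ts H (ps₁ ++ ps₂)) (just (P , (a , d))) (C₁.cfg tl H₁ (q₁ ++ n ∷ q₂)) c₂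
    forward-output (rel ts h₁ h₂ _) (aligned (refl , a∈) _ remove) Pa∈ =
      -, C₁.output (own-ext a∈ Pa∈) , rel ts h₁ h₂ remove

    forward-input : ∀ {ts H pl c₁ c₂ a b d} → Rel₁₂ (K.cfg ts H pl) c₁ c₂ →
      (O , a) ∈ ext S₁ → (a , b) ∈ chi S →
      Moves (K.cfg ts H ((b , d) ∷ pl)) (just (O , (a , d))) c₁ c₂
    forward-input {d = d} (rel ts h₁ h₂ pl) Oa∈ ab∈ =
      -, C₁.input Oa∈ ab∈₁ , rel ts h₁ h₂ (emitted d ab∈₁ ∷ˡ pl)
      where ab∈₁ = own-chi (PortNames.ext⊆portNames S₁ Oa∈) ab∈

  visible-port : ∀ {S c c′ ℓ} → Run.Step S c (just ℓ) c′ → (proj₁ ℓ , name ℓ) ∈ ext S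
  visible-port (Run.output Pa∈) = Pa∈
  visible-port (Run.input Oa∈ _) = Oa∈

  −-split : ∀ X Y {ℓ} s → (∀ {a} → a ∈ sup X → ¬ a ∈ sup Y) → name ℓ ∈ sup X →
            (ℓ ∷ s) − Y ≡ ℓ ∷ (s − Y) × (ℓ ∷ s) − X ≡ s − X
  −-split X Y s X#Y ℓ∈ =
    filter-accept (λ ℓ → ¬? (any? (λ b → name ℓ ℕ.≟ b) (sup Y))) (X#Y ℓ∈) ,
    filter-reject (λ ℓ → ¬? (any? (λ b → name ℓ ℕ.≟ b) (sup X))) (λ ℓ∉ → ℓ∉ ℓ∈)

  module Juxtaposed {S S₁ S₂ : Net} (J : Juxtaposition S S₁ S₂) where
    open Juxtaposition J
    private
      module K     = Run S
      module C₁    = Run S₁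
      module C₂    = Run S₂
      module Left  = Side J
      module Right = Side (Juxtaposition-swap J)
      X = ext S₁
      Y = ext S₂

    forward : ∀ {c c′ c₁ c₂ m} → Rel left right c c₁ c₂ → K.Step c m c′ →
              Left.Moves c′ m c₁ c₂ ⊎ Right.Moves c′ m c₂ c₁
    forward R@(rel _ _ _ pl) (K.receive {p₁ = ps₁} k a∈) with origin ps₁ pl
    ... | fromˡ refl al = inj₁ (Left.forward-receive R al a∈)
    ... | fromʳ refl al = inj₂ (Right.forward-receive (Rel-swap R) al a∈)
    forward R@(rel ts _ _ _) (K.instr {ts₁ = cs₁} ex) with origin cs₁ ts
    ... | fromˡ refl al = inj₁ (Left.forward-instr R al ex)
    ... | fromʳ refl al = inj₂ (Right.forward-instr (Rel-swap R) al ex)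
    forward R@(rel ts _ _ _) (K.ifzero-yes {ts₁ = cs₁} z) with origin cs₁ ts
    ... | fromˡ refl al = inj₁ (Left.forward-ifzero-yes R al z)
    ... | fromʳ refl al = inj₂ (Right.forward-ifzero-yes (Rel-swap R) al z)
    forward R@(rel ts _ _ _) (K.ifzero-no {ts₁ = cs₁} nz) with origin cs₁ ts
    ... | fromˡ refl al = inj₁ (Left.forward-ifzero-no R al nz)
    ... | fromʳ refl al = inj₂ (Right.forward-ifzero-no (Rel-swap R) al nz)
    forward R@(rel ts _ _ _) (K.stop {ts₁ = cs₁}) with origin cs₁ ts
    ... | fromˡ refl al = inj₁ (Left.forward-stop R al)
    ... | fromʳ refl al = inj₂ (Right.forward-stop (Rel-swap R) al)
    forward R@(rel ts _ _ _) (K.spark-local {ts₁ = cs₁} ab∈ b∈) with origin cs₁ ts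
    ... | fromˡ refl al = inj₁ (Left.forward-spark-local R al ab∈ b∈)
    ... | fromʳ refl al = inj₂ (Right.forward-spark-local (Rel-swap R) al ab∈ b∈)
    forward R@(rel ts _ _ _) (K.spark-emit {ts₁ = cs₁} ab∈ b∉) with origin cs₁ ts
    ... | fromˡ refl al = inj₁ (Left.forward-spark-emit R al ab∈ b∉)
    ... | fromʳ refl al = inj₂ (Right.forward-spark-emit (Rel-swap R) al ab∈ b∉)
    forward R@(rel _ _ _ pl) (K.output {p₁ = ps₁} Pa∈) with origin ps₁ pl
    ... | fromˡ refl al = inj₁ (Left.forward-output R al Pa∈)
    ... | fromʳ refl al = inj₂ (Right.forward-output (Rel-swap R) al Pa∈)
    forward R (K.input Oa∈ ab∈) with ext⁻ Oa∈
    ... | inj₁ Oa∈₁ = inj₁ (Left.forward-input R Oa∈₁ ab∈)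
    ... | inj₂ Oa∈₂ = inj₂ (Right.forward-input (Rel-swap R) Oa∈₂ ab∈)

    X#Y : ∀ {a} → a ∈ sup X → ¬ a ∈ sup Y
    X#Y a∈X a∈Y = disjoint (∈-++⁺ˡ a∈X , ∈-++⁺ˡ a∈Y)

    sup-⊗⁺ˡ : ∀ {a} → a ∈ sup X → a ∈ sup (X ⊗ᵢ Y)
    sup-⊗⁺ˡ a∈ = subst (_ ∈_) (sym (map-++ proj₂ X Y)) (∈-++⁺ˡ a∈)

    sup-⊗⁺ʳ : ∀ {a} → a ∈ sup Y → a ∈ sup (X ⊗ᵢ Y)
    sup-⊗⁺ʳ a∈ = subst (_ ∈_) (sym (map-++ proj₂ X Y)) (∈-++⁺ʳ (sup X) a∈)

    sup-⊗⁻ : ∀ {a} → a ∈ sup (X ⊗ᵢ Y) → a ∈ sup X ⊎ a ∈ sup Y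
    sup-⊗⁻ a∈ = ∈-++⁻ (sup X) (subst (_ ∈_) (map-++ proj₂ X Y) a∈)

    project : ∀ {c c₁ c₂ s} → Rel left right c c₁ c₂ → K.Runs c s →
              TraceOver (X ⊗ᵢ Y) s × C₁.Runs c₁ (s − Y) × C₂.Runs c₂ (s − X)
    project R K.done = [] , C₁.done , C₂.done
    project R (K.silent st r) with forward R st
    ... | inj₁ (_ , st₁ , R′) = let tr , r₁ , r₂ = project R′ r
                                in tr , C₁.silent st₁ r₁ , r₂
    ... | inj₂ (_ , st₂ , R′) = let tr , r₁ , r₂ = project (Rel-swap R′) r
                                in tr , r₁ , C₂.silent st₂ r₂
    project R (K.visible {s = s} st r) with forward R st
    ... | inj₁ (_ , st₁ , R′) =
      let tr , r₁ , r₂ = project R′ r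
          ℓ∈ = ∈-map⁺ proj₂ (visible-port st₁)
          keep , drop = −-split X Y s X#Y ℓ∈
      in sup-⊗⁺ˡ ℓ∈ ∷ tr ,
         subst (C₁.Runs _) (sym keep) (C₁.visible st₁ r₁) ,
         subst (C₂.Runs _) (sym drop) r₂
    ... | inj₂ (_ , st₂ , R′) =
      let tr , r₁ , r₂ = project (Rel-swap R′) r
          ℓ∈ = ∈-map⁺ proj₂ (visible-port st₂)
          keep , drop = −-split Y X s (λ a∈Y a∈X → X#Y a∈X a∈Y) ℓ∈
      in sup-⊗⁺ʳ ℓ∈ ∷ tr ,
         subst (C₁.Runs _) (sym drop) r₁ ,
         subst (C₂.Runs _) (sym keep) (C₂.visible st₂ r₂)

    merge : ∀ {c c₁ c₂} s → Rel left right c c₁ c₂ →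
            TraceOver (X ⊗ᵢ Y) s → C₁.Runs c₁ (s − Y) → C₂.Runs c₂ (s − X) → K.Runs c s
    merge []      R tr r₁ r₂ = K.done
    merge (ℓ ∷ s) R (ℓ∈ ∷ tr) r₁ r₂ with sup-⊗⁻ ℓ∈
    ... | inj₁ ℓ∈X =
      let keep , drop = −-split X Y s X#Y ℓ∈X
          Left.lifted R′ r₁′ prefix = Left.lift-visible R (subst (C₁.Runs _) keep r₁)
      in prefix (merge s R′ tr r₁′ (subst (C₂.Runs _) drop r₂))
    ... | inj₂ ℓ∈Y =
      let keep , drop = −-split Y X s (λ a∈Y a∈X → X#Y a∈X a∈Y) ℓ∈Y
          Right.lifted R′ r₂′ prefix = Right.lift-visible (Rel-swap R) (subst (C₂.Runs _) keep r₂)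
      in prefix (merge s (Rel-swap R′) tr (subst (C₁.Runs _) drop r₁) r₂′)

    initial-related : Rel left right K.initial C₁.initial C₂.initial
    initial-related = rel Interleaving.[] (λ _ → refl) (λ _ → refl) Interleaving.[]

    ⟦⟧-juxtaposition : ⟦ S ⟧ ≐ interleave X Y ⟦ S₁ ⟧ ⟦ S₂ ⟧
    ⟦⟧-juxtaposition s =
      project initial-related , λ (tr , r₁ , r₂) → merge s initial-related tr r₁ r₂

  ⊗ₕ-juxtaposition : ∀ {A B C D} (f : Hom A B) (g : Hom C D) →
                     Disjoint (portNames (toNet f)) (portNames (toNet g)) →
                     Juxtaposition (f ⊗ₕ g) (toNet f) (toNet g)
  ⊗ₕ-juxtaposition {A} {B} {C} {D} f g f#g = record
    { left     = record
      { isNet           = homIsNet f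
      ; embed           = inject++ˡ ef eg
      ; eng-embed       = lookup-inject++ˡ ef eg
      ; embed-injective = inject++ˡ-injective ef eg
      ; chi⁺            = ∈-++⁺ˡ
      ; ext⁺            = ⇒-⊗⁺ˡ {A} {B} {C} {D}
      }
    ; right    = record
      { isNet           = homIsNet g
      ; embed           = inject++ʳ ef eg
      ; eng-embed       = lookup-inject++ʳ ef eg
      ; embed-injective = inject++ʳ-injective ef eg
      ; chi⁺            = ∈-++⁺ʳ (homChi f)
      ; ext⁺            = ⇒-⊗⁺ʳ {A} {B} {C} {D}
      }
    ; disjoint = f#g
    ; embed≢   = inject++ˡ≢inject++ʳ ef eg
    ; embed⁻   = inject++-cover ef eg
    ; chi⁻     = ∈-++⁻ (homChi f)
    ; ext⁻     = ⇒-⊗⁻ {A} {B} {C} {D}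
    }
    where ef = homEngines f
          eg = homEngines g

theorem2 : (r rm : ℕ) (rm≤r : rm ≤ r) → let open HRAM r rm rm≤r in
           {A B C D : Interface} (f : Hom A B) (g : Hom C D) →
           Disjoint (portNames (toNet f)) (portNames (toNet g)) →
           ⟦ f ⊗ₕ g ⟧ ≐ interleave (A ⇒ B) (C ⇒ D) ⟦ toNet f ⟧ ⟦ toNet g ⟧
theorem2 r rm rm≤r f g f#g = Juxtaposed.⟦⟧-juxtaposition (⊗ₕ-juxtaposition f g f#g)
  where open Simulation r rm rm≤r
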